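{- Let $\mathcal P=\langle\mathcal S,\mathcal W,\mathcal Q,\mathcal T\rangle$ be a complexity problem and let $\mathcal R$ be a TRS. Let $\mu$ be a usable replacement map for $\mathcal R$ in $\mathcal P$, and let $\succ$ be a $\mu$-monotone order on terms that is stable under substitutions. If $\mathcal R\subseteq{\succ}$ (i.e. $l\succ r$ for every rule $l\to r\in\mathcal R$), then for every term $s\in\to_{\mathcal P}^*(\mathcal T)$ and every term $t$, $s\to^{\mathcal Q}_{\mathcal R}t$ implies $s\succ t$.
   Context: Terms are built from a signature $\mathcal F$ and a countably infinite set of variables $\mathcal V$. For TRSs $\mathcal Q,\mathcal R$ write $s\to^{\mathcal Q}_{\mathcal R}t$ iff there are a context $C$, a substitution $\sigma$ and a rule $f(l_1,\dots,l_n)\to r\in\mathcal R$ with $s=C[f(l_1\sigma,\dots,l_n\sigma)]$, $t=C[r\sigma]$, and every $l_i\sigma$ is a normal form of $\mathcal Q$. A complexity problem $\mathcal P=\langle\mathcal S,\mathcal W,\mathcal Q,\mathcal T\rangle$ consists of TRSs $\mathcal S,\mathcal W,\mathcal Q$ and a set of terms $\mathcal T$; $\to_{\mathcal P}$ denotes $\to^{\mathcal Q}_{\mathcal S\cup\mathcal W}$, and $\to_{\mathcal P}^*(\mathcal T)$ is the set of terms reachable from $\mathcal T$ by $\to_{\mathcal P}$ (the least set containing $\mathcal T$ closed under $\to_{\mathcal P}$). A replacement map $\mu$ assigns to each $n$-ary $f\in\mathcal F$ a set $\mu(f)\subseteq\{1,\dots,n\}$. The $\mu$-replacing positions are $\mathrm{Pos}_\mu(x)=\{\varepsilon\}$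 for variables $x$ and $\mathrm{Pos}_\mu(f(t_1,\dots,t_n))=\{\varepsilon\}\cup\{i\cdot p\mid i\in\mu(f),\ p\in\mathrm{Pos}_\mu(t_i)\}$. For a binary relation $\to$ on terms, $\mathcal T_\mu(\to)$ is the set of terms $s$ such that every position $p$ of $s$ at which $s|_p$ is not a normal form of $\to$ belongs to $\mathrm{Pos}_\mu(s)$. A replacement map $\mu$ is a usable replacement map for $\mathcal R$ in $\mathcal P$ if $\to_{\mathcal P}^*(\mathcal T)\subseteq\mathcal T_\mu(\to^{\mathcal Q}_{\mathcal R})$. An order (irreflexive transitive relation) $\succ$ is $\mu$-monotone if for all $f$, all $i\in\mu(f)$ and terms with $s_i\succ t_i$ we have $f(s_1,\dots,s_i,\dots,s_n)\succ f(s_1,\dots,t_i,\dots,s_n)$; it is stable under substitutions if $s\succ t$ implies $s\sigma\succ t\sigma$ for all substitutions $\sigma$. -}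

module Defs where

open import Data.Nat using (ℕ)
open import Data.Fin using (Fin)
open import Data.Vec using (Vec; []; _∷_; lookup; _[_]≔_)
open import Data.List using (List; []; _∷_)
open import Data.Product using (Σ; ∃; _×_; _,_)
open import Relation.Nullary using (¬_)
open import Relation.Binary.PropositionalEquality using (_≡_)

module Sig (F : Set) (ar : F → ℕ) where

  data Term : Set where
    var : ℕ → Term
    fun : (f : F) → Vec Term (ar f) → Term

  Subst : Set
  Subst = ℕ → Term

  mutual
    _·_ : Term → Subst → Term
    var x    · σ = σ x
    fun f ts · σ = fun f (ts ·ᵛ σ)

    _·ᵛ_ : ∀ {n} → Vec Term n → Subst → Vec Term n
    []       ·ᵛ σ = []
    (t ∷ ts) ·ᵛ σ = (t · σ) ∷ (ts ·ᵛ σ)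

  data Pos : Set where
    ε   : Pos
    _◂_ : ℕ → Pos → Pos

  data At : Term → Pos → Term → Set where
    here  : ∀ {s} → At s ε s
    there : ∀ {f ts p u} (i : Fin (ar f)) →
            At (lookup ts i) p u → At (fun f ts) (Data.Fin.toℕ i ◂ p) u

  -- Repl s p u v t : s = C[u] where C has its hole at p, and t = C[v].
  data Repl : Term → Pos → Term → Term → Term → Set where
    here  : ∀ {u v} → Repl u ε u v v
    there : ∀ {f ts p u v t'} (i : Fin (ar f)) →
            Repl (lookup ts i) p u v t' →
            Repl (fun f ts) (Data.Fin.toℕ i ◂ p) u v (fun f (ts [ i ]≔ t'))

  record Rule : Set where
    constructor _⇒_
    field
      lhs : Term
      rhs : Term
  open Rule public

  TRS : Set₁
  TRS = Rule → Set

  data Step (R : TRS) : Term → Term → Set where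
    step : ∀ {s t p l r} (σ : Subst) → R (l ⇒ r) →
           Repl s p (l · σ) (r · σ) t → Step R s t

  NFRel : (Term → Term → Set) → Term → Set
  NFRel _⟶_ s = ¬ (∃ λ t → s ⟶ t)

  NF : TRS → Term → Set
  NF Q = NFRel (Step Q)

  data QStep (Q R : TRS) : Term → Term → Set where
    qstep : ∀ {s t p f r} {ls : Vec Term (ar f)} (σ : Subst) →
            R (fun f ls ⇒ r) →
            (∀ i → NF Q (lookup ls i · σ)) →
            Repl s p (fun f ls · σ) (r · σ) t → QStep Q R s t

  _∪_ : TRS → TRS → TRS
  (R ∪ S) ρ = R ρ Data.Sum.⊎ S ρ
    where import Data.Sum

  record Problem : Set₁ where
    field
      𝒮 𝒲 𝒬 : TRS
      𝒯     : Term → Set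

  data Reach (ℙ : Problem) : Term → Set where
    base : ∀ {s} → Problem.𝒯 ℙ s → Reach ℙ s
    next : ∀ {s t} → Reach ℙ s →
           QStep (Problem.𝒬 ℙ) (Problem.𝒮 ℙ ∪ Problem.𝒲 ℙ) s t → Reach ℙ t

  ReplacementMap : Set₁
  ReplacementMap = (f : F) → Fin (ar f) → Set

  data PosMu (μ : ReplacementMap) : Term → Pos → Set where
    here  : ∀ {s} → PosMu μ s ε
    there : ∀ {f ts p} (i : Fin (ar f)) → μ f i →
            PosMu μ (lookup ts i) p → PosMu μ (fun f ts) (Data.Fin.toℕ i ◂ p)

  TMu : ReplacementMap → (Term → Term → Set) → Term → Set
  TMu μ _⟶_ s = ∀ p u → At s p u → ¬ NFRel _⟶_ u → PosMu μ s p

  UsableReplacementMap : ReplacementMap → TRS → Problem → Set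
  UsableReplacementMap μ R ℙ =
    ∀ s → Reach ℙ s → TMu μ (QStep (Problem.𝒬 ℙ) R) s

  IsOrder : (Term → Term → Set) → Set
  IsOrder _≻_ = (∀ s → ¬ (s ≻ s)) × (∀ s t u → s ≻ t → t ≻ u → s ≻ u)

  MuMonotone : ReplacementMap → (Term → Term → Set) → Set
  MuMonotone μ _≻_ = ∀ f (ts : Vec Term (ar f)) (i : Fin (ar f)) (t : Term) →
    μ f i → lookup ts i ≻ t → fun f ts ≻ fun f (ts [ i ]≔ t)

  StableSubst : (Term → Term → Set) → Set
  StableSubst _≻_ = ∀ s t (σ : Subst) → s ≻ t → (s · σ) ≻ (t · σ)

  Compatible : TRS → (Term → Term → Set) → Set
  Compatible R _≻_ = ∀ l r → R (l ⇒ r) → l ≻ r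

module Submission where

open import Defs
open import Data.Nat using (ℕ)
open import Data.Fin using (Fin; toℕ)
open import Data.Fin.Properties using (toℕ-injective)
open import Data.Vec using (Vec; lookup)
open import Data.Product using (_×_; _,_)
open import Relation.Nullary using (¬_)
open import Relation.Binary.PropositionalEquality using (_≡_; refl)

-- A Q-restricted R-step from a reachable term contracts a redex, which is not a
-- Q-restricted R-normal form; usability of μ therefore places the redex at a
-- μ-replacing position. Compatibility and stability give lσ ≻ rσ, and
-- μ-monotonicity lifts this through the context along that position.

module Rewriting (F : Set) (ar : F → ℕ) where
  open Sig F ar

  ◂-injective : ∀ {a b p q} → (a ◂ p) ≡ (b ◂ q) → a ≡ b × p ≡ q
  ◂-injective refl = refl , refl

  PosMu-there⁻ : ∀ {μ f ts i p} → PosMu μ (fun f ts) (toℕ i ◂ p) →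
                 μ f i × PosMu μ (lookup ts i) p
  PosMu-there⁻ pm = invert pm refl
    where
    invert : ∀ {μ f ts i p q} → PosMu μ (fun f ts) q → q ≡ (toℕ i ◂ p) →
             μ f i × PosMu μ (lookup ts i) p
    invert (there j μfj pm) eq with ◂-injective eq
    ... | j≡i , refl with toℕ-injective j≡i
    ...   | refl = μfj , pm

  Repl⇒At : ∀ {s p u v t} → Repl s p u v t → At s p u
  Repl⇒At here        = here
  Repl⇒At (there i r) = there i (Repl⇒At r)

  Repl-mono : ∀ {μ} {_≻_ : Term → Term → Set} → MuMonotone μ _≻_ →
              ∀ {s p u v t} → Repl s p u v t → PosMu μ s p → u ≻ v → s ≻ t
  Repl-mono mono here pm u≻v = u≻v
  Repl-mono mono {fun f ts} (there i r) pm u≻v with PosMu-there⁻ pm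
  ... | μfi , pm′ = mono f ts i _ μfi (Repl-mono mono r pm′ u≻v)

  redex-reducible : ∀ {Q R f r} {ls : Vec Term (ar f)} (σ : Subst) →
                    R (fun f ls ⇒ r) → (∀ i → NF Q (lookup ls i · σ)) →
                    ¬ NFRel (QStep Q R) (fun f ls · σ)
  redex-reducible σ rule nfs nf = nf (_ , qstep σ rule nfs here)

  QStep-decreasing : (ℙ : Problem) (R : TRS) (μ : ReplacementMap)
    (_≻_ : Term → Term → Set) → UsableReplacementMap μ R ℙ →
    MuMonotone μ _≻_ → StableSubst _≻_ → Compatible R _≻_ →
    ∀ s t → Reach ℙ s → QStep (Problem.𝒬 ℙ) R s t → s ≻ t
  QStep-decreasing ℙ R μ _≻_ usable mono stable compat s t reach
    (qstep {p = p} {f = f} {r = r} {ls = ls} σ rule nfs rep) =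
    Repl-mono mono rep redex-replacing lσ≻rσ
    where
    redex-replacing : PosMu μ s p
    redex-replacing = usable s reach p _ (Repl⇒At rep) (redex-reducible σ rule nfs)

    lσ≻rσ : (fun f ls · σ) ≻ (r · σ)
    lσ≻rσ = stable (fun f ls) r σ (compat (fun f ls) r rule)

mainTheorem1 : (F : Set) (ar : F → ℕ) →
    let open Sig F ar in
    (ℙ : Problem) (R : TRS) (μ : ReplacementMap) (_≻_ : Term → Term → Set) →
    UsableReplacementMap μ R ℙ →
    IsOrder _≻_ → MuMonotone μ _≻_ → StableSubst _≻_ →
    Compatible R _≻_ →
    ∀ s t → Reach ℙ s → QStep (Problem.𝒬 ℙ) R s t → s ≻ t
mainTheorem1 F ar ℙ R μ _≻_ usable _ =
  Rewriting.QStep-decreasing F ar ℙ R μ _≻_ usable
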